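{- Let $F$ be a field of characteristic different from $2$ and let $m\in\mathbb{N}$. Every class in $\mathsf{W}F/\mathsf{I}^{m+1}F$ is represented by a form $\varphi$ over $F$ with $\dim(\varphi)\leq 1+\sum_{j=1}^m 2^j\lambda^j(F)$.
   Context: All forms are regular quadratic forms; the right-hand side is interpreted in $\mathbb{N}\cup\{\infty\}$. $\mathsf{W}F$ is the Witt ring of $F$, $[\varphi]$ the Witt class of a form $\varphi$, $\mathsf{I}F$ the fundamental ideal, $\mathsf{I}^nF$ its $n$-th power. An $n$-fold Pfister form is $\langle 1,-a_1\rangle\otimes\cdots\otimes\langle 1,-a_n\rangle$ with $a_i\in F^\times$; $\mathsf{P}^n(F)$ is the set of their Witt classes. For $[\varphi]\in\mathsf{I}^nF$, $\lambda^n(\varphi)$ is the least $k\in\mathbb{N}$ with $[\varphi]\equiv\rho_1+\cdots+\rho_k\bmod\mathsf{I}^{n+1}F$ for some $\rho_i\in\mathsf{P}^n(F)$, and $\lambda^n(F)=\sup\{\lambda^n(\varphi):[\varphi]\in\mathsf{I}^nF\}\in\mathbb{N}\cup\{\infty\}$. -}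

module Defs where

open import Level using (Level; _⊔_)
open import Algebra.Bundles using (CommutativeRing)
open import Data.Nat using (ℕ; zero; suc; _^_)
  renaming (_*_ to _*ℕ_; _+_ to _+ℕ_)
open import Data.Nat.Divisibility using (_∣_)
open import Data.Fin using (Fin; zero; suc; _≟_)
open import Data.List using (List; []; _∷_; _++_; length; map; concatMap; foldr; lookup)
open import Data.Vec using (Vec; toList)
open import Data.List.Relation.Unary.All using (All)
open import Data.Product using (Σ; Σ-syntax; ∃; ∃-syntax; _×_; _,_)
open import Data.Bool using (if_then_else_)
open import Relation.Nullary using (¬_)
open import Relation.Nullary.Decidable using (⌊_⌋)
import Algebra.Properties.Ring as RingProps
import Algebra.Properties.Group as GroupProps
import Algebra.Properties.CommutativeSemigroup as CSProps
import Relation.Binary.Reasoning.Setoid as SetoidR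

record Field (c ℓ : Level) : Set (Level.suc (c ⊔ ℓ)) where
  field
    commutativeRing : CommutativeRing c ℓ
  open CommutativeRing commutativeRing public
  field
    1≉0     : ¬ (1# ≈ 0#)
    inverse : ∀ a → ¬ (a ≈ 0#) → ∃[ b ] (a * b ≈ 1#)

-- Quadratic form theory over a field F (char F ≠ 2 is assumed separately
-- in the statement).
module QF {c ℓ} (F : Field c ℓ) where
  open Field F hiding (zero)

  Unit : Set (c ⊔ ℓ)
  Unit = Σ[ a ∈ Carrier ] Σ[ b ∈ Carrier ] (a * b ≈ 1#)

  val : Unit → Carrier
  val (a , _) = a

  oneU : Unit
  oneU = 1# , 1# , *-identityˡ 1#

  minusOneU : Unit
  minusOneU = - 1# , - 1# , p
    where
      open RingProps ring using (-1*x≈-x)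
      open GroupProps +-group using (⁻¹-involutive)
      open SetoidR setoid
      p : - 1# * - 1# ≈ 1#
      p = begin
        - 1# * - 1# ≈⟨ -1*x≈-x (- 1#) ⟩
        - (- 1#)    ≈⟨ ⁻¹-involutive 1# ⟩
        1#          ∎

  _*U_ : Unit → Unit → Unit
  (a , a' , p) *U (b , b' , q) = a * b , a' * b' , r
    where
      open CSProps *-commutativeSemigroup using (interchange)
      open SetoidR setoid
      r : (a * b) * (a' * b') ≈ 1#
      r = begin
        (a * b) * (a' * b') ≈⟨ interchange a b a' b' ⟩
        (a * a') * (b * b') ≈⟨ *-cong p q ⟩
        1# * 1#             ≈⟨ *-identityˡ 1# ⟩
        1#                  ∎

  negU : Unit → Unit
  negU a = minusOneU *U a

  -- A (regular) quadratic form in diagonal presentation ⟨a₁,…,aₙ⟩, aᵢ ∈ F^×.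
  Form : Set (c ⊔ ℓ)
  Form = List Unit

  dim : Form → ℕ
  dim = length

  ⟨_⟩ : Unit → Form
  ⟨ a ⟩ = a ∷ []

  _⊥_ : Form → Form → Form
  _⊥_ = _++_

  _⊗_ : Form → Form → Form
  φ ⊗ ψ = concatMap (λ a → map (a *U_) ψ) φ

  -- ⟨-1⟩ ⊗ φ, representing the additive inverse in the Witt ring
  neg : Form → Form
  neg = map negU

  sumFin : (n : ℕ) → (Fin n → Carrier) → Carrier
  sumFin zero    f = 0#
  sumFin (suc n) f = f zero + sumFin n (λ i → f (suc i))

  δ : {n : ℕ} → Fin n → Fin n → Carrier
  δ i j = if ⌊ i ≟ j ⌋ then 1# else 0#

  gram : (φ : Form) → Fin (dim φ) → Fin (dim φ) → Carrier
  gram φ i j = if ⌊ i ≟ j ⌋ then val (lookup φ i) else 0#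

  _≅_ : Form → Form → Set (c ⊔ ℓ)
  φ ≅ ψ =
    Σ[ P ∈ (Fin (dim φ) → Fin (dim ψ) → Carrier) ]
    Σ[ Q ∈ (Fin (dim ψ) → Fin (dim φ) → Carrier) ]
      (∀ i j → sumFin (dim ψ) (λ k → P i k * Q k j) ≈ δ i j)
    × (∀ i j → sumFin (dim φ) (λ k → Q i k * P k j) ≈ δ i j)
    × (∀ i j → sumFin (dim φ) (λ k → sumFin (dim φ) (λ l →
                  P k i * gram φ k l * P l j)) ≈ gram ψ i j)

  ℍ : Form
  ℍ = oneU ∷ minusOneU ∷ []

  _·ℍ : ℕ → Form
  zero  ·ℍ = []
  suc k ·ℍ = ℍ ⊥ (k ·ℍ)

  _∼_ : Form → Form → Set (c ⊔ ℓ)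
  φ ∼ ψ = ∃[ k ] ∃[ l ] ((φ ⊥ (k ·ℍ)) ≅ (ψ ⊥ (l ·ℍ)))

  -- [φ] ∈ I F (fundamental ideal): even dimension
  Even : Form → Set
  Even φ = 2 ∣ dim φ

  prodForms : List Form → Form
  prodForms = foldr _⊗_ ⟨ oneU ⟩

  sumForms : List Form → Form
  sumForms = foldr _⊥_ []

  -- [φ] ∈ Iⁿ F : φ is Witt equivalent to a finite sum of terms
  -- w·x₁⋯xₙ with w ∈ W F arbitrary and each xᵢ ∈ I F
  -- (the n-th power of the ideal I F; I⁰ F = W F).
  InI : ℕ → Form → Set (c ⊔ ℓ)
  InI n φ =
    Σ[ ts ∈ List (Form × Vec Form n) ]
      All (λ t → All Even (toList (Data.Product.proj₂ t))) ts
    × (φ ∼ sumForms (map (λ t → Data.Product.proj₁ t ⊗ prodForms (toList (Data.Product.proj₂ t))) ts))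

  CongMod : ℕ → Form → Form → Set (c ⊔ ℓ)
  CongMod n φ ψ = InI n (φ ⊥ neg ψ)

  pfister : List Unit → Form
  pfister []       = ⟨ oneU ⟩
  pfister (a ∷ as) = (oneU ∷ negU a ∷ []) ⊗ pfister as

  -- λⁿ(φ) ≤ k : [φ] ≡ ρ₁+⋯+ρ_r mod Iⁿ⁺¹ F for some r ≤ k and ρᵢ ∈ Pⁿ(F)
  λ≤ : ℕ → Form → ℕ → Set (c ⊔ ℓ)
  λ≤ n φ k =
    Σ[ ps ∈ List (Vec Unit n) ]
      (length ps Data.Nat.≤ k)
    × CongMod (suc n) φ (sumForms (map (λ v → pfister (toList v)) ps))

  λF≤ : ℕ → ℕ → Set (c ⊔ ℓ)
  λF≤ n k = ∀ φ → InI n φ → λ≤ n φ k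

weightedSum : (ℕ → ℕ) → ℕ → ℕ
weightedSum L zero    = 0
weightedSum L (suc m) = weightedSum L m +ℕ (2 ^ suc m) *ℕ L (suc m)

{-# OPTIONS --safe #-}
-- Every form is congruent mod I F to ⟨⟩ or ⟨1⟩, according to the
-- parity of its dimension.  If φ represents ψ mod I^(m+1) F, then ψ ⊥ -φ lies in
-- I^(m+1) F, so modulo I^(m+2) F it is a sum of at most λ^(m+1)(F) Pfister forms,
-- each of dimension 2^(m+1); adjoining that sum to φ represents ψ mod I^(m+2) F.
module Submission where

open import Defs
open import Data.Nat.Base using (ℕ; zero; suc)
open import Data.Fin using (Fin; zero; suc; _≟_)
open import Data.List using (List; []; _∷_)
open import Data.List.Relation.Binary.Pointwise using (Pointwise; []; _∷_)
open import Data.Product using (_,_)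
open import Data.Bool using (true; false)
open import Relation.Nullary using (¬_; _because_)
open import Relation.Binary.PropositionalEquality as ≡ using (_≡_)

module _ {c ℓ} (F : Field c ℓ) where
  open Field F hiding (zero)
  open QF F

  sumFin-cong : ∀ n {f g : Fin n → Carrier} → (∀ i → f i ≈ g i) → sumFin n f ≈ sumFin n g
  sumFin-cong zero    f≈g = refl
  sumFin-cong (suc n) f≈g = +-cong (f≈g zero) (sumFin-cong n (λ i → f≈g (suc i)))

  sumFin-zero : ∀ n {f : Fin n → Carrier} → (∀ i → f i ≈ 0#) → sumFin n f ≈ 0#
  sumFin-zero zero    f≈0 = refl
  sumFin-zero (suc n) f≈0 =
    trans (+-cong (f≈0 zero) (sumFin-zero n (λ i → f≈0 (suc i)))) (+-identityˡ 0#)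

  +-sumFin-zeroʳ : ∀ n x {f : Fin n → Carrier} → (∀ i → f i ≈ 0#) → x + sumFin n f ≈ x
  +-sumFin-zeroʳ n x f≈0 = trans (+-congˡ (sumFin-zero n f≈0)) (+-identityʳ x)

  0+-cong : ∀ {x y z} → x ≈ 0# → y ≈ z → x + y ≈ z
  0+-cong {y = y} x≈0 y≈z = trans (+-congʳ x≈0) (trans (+-identityˡ y) y≈z)

  δ-suc : ∀ {n} (i j : Fin n) → δ (suc i) (suc j) ≡ δ i j
  δ-suc i j with i ≟ j
  ... | true  because _ = ≡.refl
  ... | false because _ = ≡.refl

  gram-suc : ∀ a φ (i j : Fin (dim φ)) → gram (a ∷ φ) (suc i) (suc j) ≡ gram φ i j
  gram-suc a φ i j with i ≟ j
  ... | true  because _ = ≡.refl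
  ... | false because _ = ≡.refl

  Matrix : ℕ → ℕ → Set c
  Matrix m n = Fin m → Fin n → Carrier

  1⊕_ : ∀ {m n} → Matrix m n → Matrix (suc m) (suc n)
  (1⊕ A) zero    zero    = 1#
  (1⊕ A) zero    (suc j) = 0#
  (1⊕ A) (suc i) zero    = 0#
  (1⊕ A) (suc i) (suc j) = A i j

  1⊕-inverse : ∀ {m n} (A : Matrix m n) (B : Matrix n m) →
    (∀ i j → sumFin n (λ k → A i k * B k j) ≈ δ i j) →
    ∀ i j → sumFin (suc n) (λ k → (1⊕ A) i k * (1⊕ B) k j) ≈ δ i j
  1⊕-inverse {n = n} A B AB≈I zero zero =
    trans (+-sumFin-zeroʳ n _ (λ _ → zeroˡ 0#)) (*-identityˡ 1#)
  1⊕-inverse {n = n} A B AB≈I zero (suc j) =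
    0+-cong (zeroʳ 1#) (sumFin-zero n (λ k → zeroˡ (B k j)))
  1⊕-inverse {n = n} A B AB≈I (suc i) zero =
    0+-cong (zeroˡ 1#) (sumFin-zero n (λ k → zeroʳ (A i k)))
  1⊕-inverse A B AB≈I (suc i) (suc j) =
    0+-cong (zeroˡ 0#) (trans (AB≈I i j) (reflexive (≡.sym (δ-suc i j))))

  gram-transform : ∀ {n} (φ : Form) → Matrix (dim φ) n → Matrix n n
  gram-transform φ P i j =
    sumFin (dim φ) (λ k → sumFin (dim φ) (λ l → P k i * gram φ k l * P l j))

  gram-transform-1⊕ : ∀ a φ {n} (P : Matrix (dim φ) n) (i j : Fin (suc n)) →
    gram-transform (a ∷ φ) (1⊕ P) i j ≈
      (1⊕ P) zero i * val a * (1⊕ P) zero j + gram-transform φ (λ k → (1⊕ P) (suc k)) i j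
  gram-transform-1⊕ a φ P i j = +-cong
    (+-sumFin-zeroʳ (dim φ) _ (λ l → trans (*-congʳ (zeroʳ _)) (zeroˡ _)))
    (sumFin-cong (dim φ) λ k → 0+-cong (trans (*-congʳ (zeroʳ _)) (zeroˡ _))
      (sumFin-cong (dim φ) λ l → *-congʳ (*-congˡ (reflexive (gram-suc a φ k l)))))

  ≅-∷ : ∀ {a b φ ψ} → val a ≈ val b → φ ≅ ψ → (a ∷ φ) ≅ (b ∷ ψ)
  ≅-∷ {a} {b} {φ} {ψ} a≈b (P , Q , PQ≈I , QP≈I , PᵀGP≈G) =
    1⊕ P , 1⊕ Q , 1⊕-inverse P Q PQ≈I , 1⊕-inverse Q P QP≈I , congruent
    where
      n = dim φ
      0*x*y≈0 : ∀ x y → 0# * x * y ≈ 0#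
      0*x*y≈0 x y = trans (*-congʳ (zeroˡ x)) (zeroˡ y)
      congruent : ∀ i j → gram-transform (a ∷ φ) (1⊕ P) i j ≈ gram (b ∷ ψ) i j
      congruent i j = trans (gram-transform-1⊕ a φ P i j) (split i j)
        where
          split : ∀ i j → (1⊕ P) zero i * val a * (1⊕ P) zero j
                            + gram-transform φ (λ k → (1⊕ P) (suc k)) i j ≈ gram (b ∷ ψ) i j
          split zero zero = trans
            (+-sumFin-zeroʳ n _ (λ _ → sumFin-zero n (λ _ → 0*x*y≈0 _ _)))
            (trans (trans (*-identityʳ _) (*-identityˡ _)) a≈b)
          split zero (suc j) =
            0+-cong (zeroʳ _) (sumFin-zero n (λ _ → sumFin-zero n (λ _ → 0*x*y≈0 _ _)))
          split (suc i) zero =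
            0+-cong (0*x*y≈0 _ _) (sumFin-zero n (λ _ → sumFin-zero n (λ _ → zeroʳ _)))
          split (suc i) (suc j) =
            0+-cong (zeroʳ _) (trans (PᵀGP≈G i j) (reflexive (≡.sym (gram-suc b ψ i j))))

  []≅[] : [] ≅ []
  []≅[] = (λ ()) , (λ ()) , (λ ()) , (λ ()) , (λ ())

  _≈ᵘ_ : Unit → Unit → Set ℓ
  a ≈ᵘ b = val a ≈ val b

  Pointwise⇒≅ : ∀ {φ ψ} → Pointwise _≈ᵘ_ φ ψ → φ ≅ ψ
  Pointwise⇒≅ []                           = []≅[]
  Pointwise⇒≅ {a ∷ φ} {b ∷ ψ} (a≈b ∷ φ≈ψ) = ≅-∷ {a} {b} {φ} {ψ} a≈b (Pointwise⇒≅ φ≈ψ)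

  ⊗-identity : ∀ χ → Pointwise _≈ᵘ_ χ (⟨ oneU ⟩ ⊗ (χ ⊗ ⟨ oneU ⟩))
  ⊗-identity []      = []
  ⊗-identity (x ∷ χ) = sym (trans (*-identityˡ _) (*-identityʳ _)) ∷ ⊗-identity χ

-- ℕ arithmetic is opened only from here on: above, _+_ and _*_ are the field's.
open import Data.Nat using (_≤_; _+_; _*_; _^_; z≤n; s≤s)
import Data.Nat.Properties as ℕ
open import Data.Nat.Divisibility using (_∣_; divides)
open import Data.List using (_++_; map; replicate; length)
import Data.List.Properties as List
open import Data.List.Relation.Binary.Pointwise using (++⁺)
open import Data.List.Relation.Unary.All using ([]; _∷_)
open import Data.Vec using (Vec; toList; []; _∷_)
import Data.Vec.Properties as Vec
open import Data.Product using (∃-syntax; _×_)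

even-after-adding≤1 : ∀ n → ∃[ r ] (r ≤ 1 × 2 ∣ n + r)
even-after-adding≤1 zero          = 0 , z≤n , divides 0 ≡.refl
even-after-adding≤1 (suc zero)    = 1 , s≤s z≤n , divides 1 ≡.refl
even-after-adding≤1 (suc (suc n)) with even-after-adding≤1 n
... | r , r≤1 , divides q eq = r , r≤1 , divides (suc q) (≡.cong (2 +_) eq)

module _ {c ℓ} (F : Field c ℓ) where
  open QF F

  dim-⊥ : ∀ φ ψ → dim (φ ⊥ ψ) ≡ dim φ + dim ψ
  dim-⊥ φ ψ = List.length-++ φ

  dim-⊗ : ∀ φ ψ → dim (φ ⊗ ψ) ≡ dim φ * dim ψ
  dim-⊗ []      ψ = ≡.refl
  dim-⊗ (a ∷ φ) ψ = begin
    dim (map (a *U_) ψ ⊥ (φ ⊗ ψ))     ≡⟨ dim-⊥ (map (a *U_) ψ) (φ ⊗ ψ) ⟩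
    dim (map (a *U_) ψ) + dim (φ ⊗ ψ) ≡⟨ ≡.cong₂ _+_ (List.length-map (a *U_) ψ) (dim-⊗ φ ψ) ⟩
    dim ψ + dim φ * dim ψ             ∎
    where open ≡.≡-Reasoning

  dim-pfister : ∀ as → dim (pfister as) ≡ 2 ^ length as
  dim-pfister []       = ≡.refl
  dim-pfister (a ∷ as) =
    ≡.trans (dim-⊗ (oneU ∷ negU a ∷ []) (pfister as)) (≡.cong (2 *_) (dim-pfister as))

  dim-sum-pfister : ∀ {n} (ps : List (Vec Unit n)) →
    dim (sumForms (map (λ v → pfister (toList v)) ps)) ≡ length ps * 2 ^ n
  dim-sum-pfister []       = ≡.refl
  dim-sum-pfister (p ∷ ps) = ≡.trans (dim-⊥ (pfister (toList p)) _)
    (≡.cong₂ _+_ (≡.trans (dim-pfister (toList p)) (≡.cong (2 ^_) (Vec.length-toList p)))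
                 (dim-sum-pfister ps))

  even⇒InI1 : ∀ χ → Even χ → InI 1 χ
  even⇒InI1 χ 2∣dimχ =
    ((⟨ oneU ⟩ , χ ∷ []) ∷ []) , ((2∣dimχ ∷ []) ∷ []) , 0 , 0 ,
    Pointwise⇒≅ F (++⁺ χ≈1·χ [])
    where
      1·χ = ⟨ oneU ⟩ ⊗ (χ ⊗ ⟨ oneU ⟩) ++ []
      χ≈1·χ : Pointwise (_≈ᵘ_ F) χ 1·χ
      χ≈1·χ = ≡.subst (λ φ → Pointwise (_≈ᵘ_ F) φ 1·χ) (List.++-identityʳ χ)
                      (++⁺ (⊗-identity F χ) [])

  congMod1-dim≤1 : ∀ ψ → ∃[ φ ] (CongMod 1 ψ φ × dim φ ≤ 1)
  congMod1-dim≤1 ψ with even-after-adding≤1 (dim ψ)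
  ... | r , r≤1 , 2∣dimψ+r =
    ones , even⇒InI1 (ψ ⊥ neg ones) (≡.subst (2 ∣_) (≡.sym dim-ψ-ones) 2∣dimψ+r) ,
    ≡.subst (_≤ 1) (≡.sym (List.length-replicate r)) r≤1
    where
      ones = replicate r oneU
      dim-ψ-ones : dim (ψ ⊥ neg ones) ≡ dim ψ + r
      dim-ψ-ones = ≡.trans (dim-⊥ ψ (neg ones))
        (≡.cong (dim ψ +_) (≡.trans (List.length-map negU ones) (List.length-replicate r)))

  λ≤⇒congMod-dim≤ : ∀ {n k} χ → λ≤ n χ k → ∃[ σ ] (CongMod (suc n) χ σ × dim σ ≤ 2 ^ n * k)
  λ≤⇒congMod-dim≤ {n} {k} χ (ps , length≤k , χ≡sum) = _ , χ≡sum , (begin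
    dim (sumForms (map (λ v → pfister (toList v)) ps)) ≡⟨ dim-sum-pfister ps ⟩
    length ps * 2 ^ n                                  ≡⟨ ℕ.*-comm (length ps) (2 ^ n) ⟩
    2 ^ n * length ps                                  ≤⟨ ℕ.*-monoʳ-≤ (2 ^ n) length≤k ⟩
    2 ^ n * k                                          ∎)
    where open ℕ.≤-Reasoning

  congMod-accumulate : ∀ {n} ψ φ σ → CongMod n (ψ ⊥ neg φ) σ → CongMod n ψ (φ ⊥ σ)
  congMod-accumulate {n} ψ φ σ = ≡.subst (InI n) (begin
    (ψ ++ map negU φ) ++ map negU σ ≡⟨ List.++-assoc ψ (map negU φ) (map negU σ) ⟩
    ψ ++ (map negU φ ++ map negU σ) ≡⟨ ≡.cong (ψ ++_) (List.map-++ negU φ σ) ⟨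
    ψ ++ map negU (φ ++ σ)          ∎)
    where open ≡.≡-Reasoning

  congMod-step : ∀ {n k} → λF≤ n k → ∀ ψ φ → CongMod n ψ φ →
    ∃[ φ′ ] (CongMod (suc n) ψ φ′ × dim φ′ ≤ dim φ + 2 ^ n * k)
  congMod-step λF≤k ψ φ ψ≡φ
    with λ≤⇒congMod-dim≤ (ψ ⊥ neg φ) (λF≤k (ψ ⊥ neg φ) ψ≡φ)
  ... | σ , ψ-φ≡σ , dimσ≤ =
    φ ⊥ σ , congMod-accumulate ψ φ σ ψ-φ≡σ ,
    ℕ.≤-trans (ℕ.≤-reflexive (dim-⊥ φ σ)) (ℕ.+-monoʳ-≤ (dim φ) dimσ≤)

lemma2p5 : ∀ {c ℓ} (F : Field c ℓ) →
    ¬ (Field._≈_ F (Field._+_ F (Field.1# F) (Field.1# F)) (Field.0# F)) →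
    (m : ℕ) (L : ℕ → ℕ) →
    (∀ j → 1 ≤ j → j ≤ m → QF.λF≤ F j (L j)) →
    ∀ (ψ : QF.Form F) →
      ∃[ φ ] (QF.CongMod F (suc m) ψ φ × QF.dim F φ ≤ 1 + weightedSum L m)
lemma2p5 F _ zero L _ ψ = congMod1-dim≤1 F ψ
lemma2p5 F char≠2 (suc m) L λF≤L ψ
  with lemma2p5 F char≠2 m L (λ j 1≤j j≤m → λF≤L j 1≤j (ℕ.m≤n⇒m≤1+n j≤m)) ψ
... | φ , ψ≡φ , dimφ≤
  with congMod-step F (λF≤L (suc m) (s≤s z≤n) ℕ.≤-refl) ψ φ ψ≡φ
... | φ′ , ψ≡φ′ , dimφ′≤ = φ′ , ψ≡φ′ , ℕ.≤-trans dimφ′≤ (ℕ.+-monoˡ-≤ _ dimφ≤)
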